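{- Let $(P,\leq,{}',0,1)$ be a Boolean poset and define $M(x,y):=L(x,y)$ and $R(x,y):=L(U(x',y))$ for all $x,y\in P$. Then $(P,\leq,{}',M,R,0,1)$ is an operator residuated poset satisfying divisibility, i.e. $M(R(x,y),x)=L(x,y)$ for all $x,y\in P$.
   Context: For a poset $(P,\leq)$ and $A\subseteq P$ let $L(A)=\{x\in P\mid x\leq y\text{ for all }y\in A\}$ and $U(A)=\{x\in P\mid y\leq x\text{ for all }y\in A\}$; we write $L(a,b)$ for $L(\{a,b\})$, $L(A,a)$ for $L(A\cup\{a\})$, $L(A,B)$ for $L(A\cup B)$, etc., and similarly for $U$. A poset is distributive if $L(U(x,y),z)=L(U(L(x,z),L(y,z)))$ for all $x,y,z$ (equivalently $U(L(x,y),z)=U(L(U(x,z),U(y,z)))$). A poset with complementation is $(P,\leq,{}',0,1)$ with $(P,\leq,0,1)$ a bounded poset and $'$ a unary operation such that $L(x,x')=\{0\}$, $U(x,x')=\{1\}$, $x\leq y$ implies $y'\leq x'$, and $(x')'=x$. A Boolean poset is a distributive poset with complementation. An operator left residuated poset is a system $(P,\leq,{}',M,R,0,1)$ where $(P,\leq,0,1)$ is bounded, $'$ is a unary operation, and $M,R:P^2\to 2^P$ satisfy for all $x,y,z$: (1) $M(x,1)=M(1,x)=L(x)$; (2) $R(x,y)=P$ iff $x\leq y$; (3) $M(x,y)\subseteq L(z)$ iff $L(x)\subseteq R(y,z)$; (4) $R(x,0)=L(x')$. It is an operator residuated poset if moreover $M(x,y)=M(y,x)$ for all $x,y$. For $A,B\subseteq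 P$, $M(A,B):=\bigcup_{(x,y)\in A\times B}M(x,y)$ and $R(A,B):=\bigcup_{(x,y)\in A\times B}R(x,y)$; divisibility is the identity $M(R(x,y),x)=L(x,y)$. -}

module Defs where

open import Level using (Level; suc; Lift)
open import Data.Unit using (⊤)
open import Data.Product using (Σ; _×_; _,_)
open import Data.Sum using (_⊎_)
open import Function.Bundles using (_⇔_)
open import Relation.Binary.PropositionalEquality using (_≡_)
open import Relation.Binary.Structures using (IsPartialOrder)
open import Relation.Unary using (Pred; _⊆_; _∪_)

module _ {a : Level} {P : Set a} where

  Whole : Pred P a
  Whole _ = Lift a ⊤

  _≐_ : Pred P a → Pred P a → Set a
  A ≐ B = (A ⊆ B) × (B ⊆ A)

  ⟦_⟧ : P → Pred P a
  ⟦ x ⟧ z = z ≡ x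

  ⟦_⸴_⟧ : P → P → Pred P a
  ⟦ x ⸴ y ⟧ z = (z ≡ x) ⊎ (z ≡ y)

  liftM : (P → P → Pred P a) → Pred P a → Pred P a → Pred P a
  liftM M A B z = Σ P λ x → Σ P λ y → A x × B y × M x y z

record BoundedPoset (a : Level) : Set (suc a) where
  field
    Carrier : Set a
    _≤_ : Carrier → Carrier → Set a
    isPartialOrder : IsPartialOrder _≡_ _≤_
    𝟘 𝟙 : Carrier
    𝟘-min : ∀ x → 𝟘 ≤ x
    𝟙-max : ∀ x → x ≤ 𝟙

  L : Pred Carrier a → Pred Carrier a
  L A x = ∀ y → A y → x ≤ y

  Up : Pred Carrier a → Pred Carrier a
  Up A x = ∀ y → A y → y ≤ x

  -- distributivity: L(U(x,y),z) = L(U(L(x,z),L(y,z)))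
  Distributive : Set a
  Distributive = ∀ x y z →
    L (Up ⟦ x ⸴ y ⟧ ∪ ⟦ z ⟧) ≐ L (Up (L ⟦ x ⸴ z ⟧ ∪ L ⟦ y ⸴ z ⟧))

  record IsComplementation (_′ : Carrier → Carrier) : Set a where
    field
      L-x-x′ : ∀ x → L ⟦ x ⸴ x ′ ⟧ ≐ ⟦ 𝟘 ⟧
      U-x-x′ : ∀ x → Up ⟦ x ⸴ x ′ ⟧ ≐ ⟦ 𝟙 ⟧
      antitone : ∀ x y → x ≤ y → (y ′) ≤ (x ′)
      involutive : ∀ x → (x ′) ′ ≡ x

  record IsOperatorLeftResiduated (_′ : Carrier → Carrier)
      (M R : Carrier → Carrier → Pred Carrier a) : Set a where
    field
      M-x-1 : ∀ x → M x 𝟙 ≐ L ⟦ x ⟧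
      M-1-x : ∀ x → M 𝟙 x ≐ L ⟦ x ⟧
      R-full : ∀ x y → (R x y ≐ Whole) ⇔ (x ≤ y)
      adjoint : ∀ x y z → (M x y ⊆ L ⟦ z ⟧) ⇔ (L ⟦ x ⟧ ⊆ R y z)
      R-x-0 : ∀ x → R x 𝟘 ≐ L ⟦ x ′ ⟧

  record IsOperatorResiduated (_′ : Carrier → Carrier)
      (M R : Carrier → Carrier → Pred Carrier a) : Set a where
    field
      isOperatorLeftResiduated : IsOperatorLeftResiduated _′ M R
      M-comm : ∀ x y → M x y ≐ M y x

  Divisible : (M R : Carrier → Carrier → Pred Carrier a) → Set a
  Divisible M R = ∀ x y → liftM M (R x y) ⟦ x ⟧ ≐ L ⟦ x ⸴ y ⟧

record BooleanPoset (a : Level) : Set (suc a) where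
  field
    boundedPoset : BoundedPoset a
  open BoundedPoset boundedPoset public
  field
    _′ : Carrier → Carrier
    isComplementation : IsComplementation _′
    distributive : Distributive

module Submission where

-- With M(x,y) = L(x,y) and R(y,z) = L(U(y′,z)) everything reduces to one
-- characterisation of the residual cone (`R-char`):
--
--     w ∈ R(y,z)  iff  every common lower bound of w and y lies below z,
--
-- the poset form of "w ≤ y′ ∨ z iff w ∧ y ≤ z".  It rests on two consequences
-- of distributivity and complementation: `cancel` (y ∧ (y′ ∨ z) ≤ z) and
-- `split-by-complement` (w ≤ (y ∧ w) ∨ (y′ ∧ w)).

open import Level using (Level; lift)
open import Data.Product using (_×_; _,_; proj₁)
open import Data.Sum using (inj₁; inj₂)
open import Data.Unit using (tt)
open import Function.Bundles using (_⇔_; mk⇔; Equivalence)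
open import Relation.Binary.PropositionalEquality using (refl; sym; subst)
open import Relation.Binary.Structures using (IsPartialOrder)
open import Relation.Unary using (Pred; _⊆_; _∪_)
open import Defs

module Cones {a : Level} (P : BoundedPoset a) where
  open BoundedPoset P
  open IsPartialOrder isPartialOrder using (trans)

  L₁-intro : ∀ {w x} → w ≤ x → L ⟦ x ⟧ w
  L₁-intro w≤x _ refl = w≤x

  L₁-elim : ∀ {w x} → L ⟦ x ⟧ w → w ≤ x
  L₁-elim w∈L = w∈L _ refl

  L₂-intro : ∀ {w x y} → w ≤ x → w ≤ y → L ⟦ x ⸴ y ⟧ w
  L₂-intro w≤x _ _ (inj₁ refl) = w≤x
  L₂-intro _ w≤y _ (inj₂ refl) = w≤y

  L₂-left : ∀ {w x y} → L ⟦ x ⸴ y ⟧ w → w ≤ x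
  L₂-left w∈L = w∈L _ (inj₁ refl)

  L₂-right : ∀ {w x y} → L ⟦ x ⸴ y ⟧ w → w ≤ y
  L₂-right w∈L = w∈L _ (inj₂ refl)

  U₂-left : ∀ {u x y} → Up ⟦ x ⸴ y ⟧ u → x ≤ u
  U₂-left u∈U = u∈U _ (inj₁ refl)

  U₂-right : ∀ {u x y} → Up ⟦ x ⸴ y ⟧ u → y ≤ u
  U₂-right u∈U = u∈U _ (inj₂ refl)

  L₂-comm : ∀ x y → L ⟦ x ⸴ y ⟧ ≐ L ⟦ y ⸴ x ⟧
  L₂-comm x y = swap , swap
    where
    swap : ∀ {x y} → L ⟦ x ⸴ y ⟧ ⊆ L ⟦ y ⸴ x ⟧
    swap w∈L = L₂-intro (L₂-right w∈L) (L₂-left w∈L)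

  L₂-𝟙ʳ : ∀ x → L ⟦ x ⸴ 𝟙 ⟧ ≐ L ⟦ x ⟧
  L₂-𝟙ʳ x = (λ w∈L → L₁-intro (L₂-left w∈L))
          , (λ w∈L → L₂-intro (L₁-elim w∈L) (𝟙-max _))

  L₂-𝟙ˡ : ∀ x → L ⟦ 𝟙 ⸴ x ⟧ ≐ L ⟦ x ⟧
  L₂-𝟙ˡ x = (λ w∈L → L₁-intro (L₂-right w∈L))
          , (λ w∈L → L₂-intro (𝟙-max _) (L₁-elim w∈L))

module Complements {a : Level} (P : BoundedPoset a) (_′ : BoundedPoset.Carrier P → BoundedPoset.Carrier P)
                   (isComplementation : BoundedPoset.IsComplementation P _′) where
  open BoundedPoset P
  open IsComplementation isComplementation
  open Cones P

  below-both-is-least : ∀ {v y} z → v ≤ y → v ≤ (y ′) → v ≤ z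
  below-both-is-least z v≤y v≤y′ =
    subst (_≤ z) (sym (proj₁ (L-x-x′ _) (L₂-intro v≤y v≤y′))) (𝟘-min z)

  above-both-is-greatest : ∀ {u y} w → y ≤ u → (y ′) ≤ u → w ≤ u
  above-both-is-greatest w y≤u y′≤u =
    subst (w ≤_) (sym (proj₁ (U-x-x′ _) u∈U)) (𝟙-max w)
    where
    u∈U : Up ⟦ _ ⸴ _ ′ ⟧ _
    u∈U _ (inj₁ refl) = y≤u
    u∈U _ (inj₂ refl) = y′≤u

module Residual {a : Level} (B : BooleanPoset a) where
  open BooleanPoset B
  open IsPartialOrder isPartialOrder using (trans) renaming (refl to ≤-refl)
  open Cones boundedPoset
  open Complements boundedPoset _′ isComplementation

  -- y ∧ (y′ ∨ z) ≤ z: distributivity turns L(U(y′,z),y) into L(U(L(y′,y),L(z,y))),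
  -- and z bounds L(y′,y) = {0} and L(z,y) from above.
  cancel : ∀ {y z w} → L (Up ⟦ y ′ ⸴ z ⟧) w → w ≤ y → w ≤ z
  cancel {y} {z} {w} w∈L w≤y = proj₁ (distributive (y ′) z y) w∈lhs z z-upper
    where
    w∈lhs : L (Up ⟦ y ′ ⸴ z ⟧ ∪ ⟦ y ⟧) w
    w∈lhs v (inj₁ v∈U) = w∈L v v∈U
    w∈lhs v (inj₂ refl) = w≤y
    z-upper : Up (L ⟦ y ′ ⸴ y ⟧ ∪ L ⟦ z ⸴ y ⟧) z
    z-upper v (inj₁ v∈L) = below-both-is-least z (L₂-right v∈L) (L₂-left v∈L)
    z-upper v (inj₂ v∈L) = L₂-left v∈L

  -- w ≤ (y ∧ w) ∨ (y′ ∧ w): distributivity turns L(U(y,y′),w) = L(w) into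
  -- L(U(L(y,w),L(y′,w))), so an upper bound of both parts bounds w.
  split-by-complement : ∀ y {w u} →
    (∀ {v} → v ≤ y → v ≤ w → v ≤ u) → (∀ {v} → v ≤ (y ′) → v ≤ w → v ≤ u) → w ≤ u
  split-by-complement y {w} {u} below-y below-y′ =
    proj₁ (distributive y (y ′) w) w∈lhs u u-upper
    where
    w∈lhs : L (Up ⟦ y ⸴ y ′ ⟧ ∪ ⟦ w ⟧) w
    w∈lhs v (inj₁ v∈U) = above-both-is-greatest w (U₂-left v∈U) (U₂-right v∈U)
    w∈lhs v (inj₂ refl) = ≤-refl
    u-upper : Up (L ⟦ y ⸴ w ⟧ ∪ L ⟦ y ′ ⸴ w ⟧) u
    u-upper v (inj₁ v∈L) = below-y (L₂-left v∈L) (L₂-right v∈L)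
    u-upper v (inj₂ v∈L) = below-y′ (L₂-left v∈L) (L₂-right v∈L)

  M : Carrier → Carrier → Pred Carrier a
  M x y = L ⟦ x ⸴ y ⟧

  R : Carrier → Carrier → Pred Carrier a
  R y z = L (Up ⟦ y ′ ⸴ z ⟧)

  R-char : ∀ {y z w} → R y z w ⇔ (∀ {v} → v ≤ w → v ≤ y → v ≤ z)
  R-char {y} {z} {w} = mk⇔ to from
    where
    to : R y z w → ∀ {v} → v ≤ w → v ≤ y → v ≤ z
    to w∈R v≤w = cancel (λ u u∈U → trans v≤w (w∈R u u∈U))
    from : (∀ {v} → v ≤ w → v ≤ y → v ≤ z) → R y z w
    from meet≤z u u∈U = split-by-complement y
      (λ v≤y v≤w → trans (meet≤z v≤w v≤y) (U₂-right u∈U))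
      (λ v≤y′ _ → trans v≤y′ (U₂-left u∈U))

module Axioms {a : Level} (B : BooleanPoset a) where
  open BooleanPoset B
  open IsPartialOrder isPartialOrder using (trans) renaming (refl to ≤-refl)
  open Cones boundedPoset
  open Residual B

  -- R(x,y) = P iff x ≤ y; for "only if" apply R-char to 1 ∈ R(x,y) and the
  -- common lower bound x of 1 and x
  R-full : ∀ x y → (R x y ≐ Whole) ⇔ (x ≤ y)
  R-full x y = mk⇔ to from
    where
    to : R x y ≐ Whole → x ≤ y
    to (_ , Whole⊆R) = Equivalence.to R-char (Whole⊆R {𝟙} (lift tt)) (𝟙-max x) ≤-refl
    from : x ≤ y → R x y ≐ Whole
    from x≤y = (λ _ → lift tt)
             , (λ {w} _ → Equivalence.from (R-char {w = w}) (λ _ v≤x → trans v≤x x≤y))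

  -- M(x,y) ⊆ L(z) iff L(x) ⊆ R(y,z): both say that L(x,y) lies below z
  adjoint : ∀ x y z → (M x y ⊆ L ⟦ z ⟧) ⇔ (L ⟦ x ⟧ ⊆ R y z)
  adjoint x y z = mk⇔ to from
    where
    to : M x y ⊆ L ⟦ z ⟧ → L ⟦ x ⟧ ⊆ R y z
    to M⊆Lz {w} w∈Lx = Equivalence.from R-char λ {v} v≤w v≤y →
      L₁-elim (M⊆Lz {v} (L₂-intro (trans v≤w (L₁-elim w∈Lx)) v≤y))
    from : L ⟦ x ⟧ ⊆ R y z → M x y ⊆ L ⟦ z ⟧
    from Lx⊆R {w} w∈M = L₁-intro
      (Equivalence.to R-char (Lx⊆R {w} (L₁-intro (L₂-left w∈M))) ≤-refl (L₂-right w∈M))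

  -- R(x,0) = L(x′), since U(x′,0) = U(x′)
  R-𝟘 : ∀ x → R x 𝟘 ≐ L ⟦ x ′ ⟧
  R-𝟘 x = (λ w∈R → L₁-intro (w∈R (x ′) x′∈U))
        , (λ w∈L u u∈U → trans (L₁-elim w∈L) (U₂-left u∈U))
    where
    x′∈U : Up ⟦ x ′ ⸴ 𝟘 ⟧ (x ′)
    x′∈U _ (inj₁ refl) = ≤-refl
    x′∈U _ (inj₂ refl) = 𝟘-min _

  -- M(R(x,y),x) = L(x,y): ⊆ by R-char applied to the bound z of p and x;
  -- ⊇ with z itself as the witness in R(x,y)
  divisible : Divisible M R
  divisible x y = sound , complete
    where
    sound : liftM M (R x y) ⟦ x ⟧ ⊆ L ⟦ x ⸴ y ⟧
    sound (_ , _ , p∈R , refl , z∈M) =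
      L₂-intro (L₂-right z∈M) (Equivalence.to R-char p∈R (L₂-left z∈M) (L₂-right z∈M))
    complete : L ⟦ x ⸴ y ⟧ ⊆ liftM M (R x y) ⟦ x ⟧
    complete {z} z∈L = z , x , z∈R , refl , L₂-intro ≤-refl (L₂-left z∈L)
      where
      z∈R : R x y z
      z∈R = Equivalence.from R-char (λ v≤z _ → trans v≤z (L₂-right z∈L))

  isOperatorResiduated : IsOperatorResiduated _′ M R
  isOperatorResiduated = record
    { isOperatorLeftResiduated = record
      { M-x-1 = L₂-𝟙ʳ
      ; M-1-x = L₂-𝟙ˡ
      ; R-full = R-full
      ; adjoint = adjoint
      ; R-x-0 = R-𝟘
      }
    ; M-comm = L₂-comm
    }

theorem2 : ∀ {a : Level} (B : BooleanPoset a) →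
    let open BooleanPoset B
        M = λ x y → L ⟦ x ⸴ y ⟧
        R = λ x y → L (Up ⟦ x ′ ⸴ y ⟧)
    in IsOperatorResiduated _′ M R × Divisible M R
theorem2 B = isOperatorResiduated , divisible
  where open Axioms B
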